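{- For every weight vector $\omega=(\omega_1,\omega_2,\ldots)$ and every $n\ge1$, $$P_{n,\omega}=\sum_{j=1}^{n}\omega_jt_jF_{n-j}.$$
   Context: Let $t_1,t_2,\ldots$ be indeterminates. For a finitely supported vector $\alpha$ of nonnegative integers write $t^\alpha=\prod_j t_j^{\alpha_j}$, $|\alpha|=\sum_j\alpha_j$, and $\alpha\vdash n$ if $\sum_j j\alpha_j=n$. For a rational weight vector $\omega$ define $A_\omega(e_j)=\omega_j$ ($e_j$ the $j$-th unit vector) and, for $|\alpha|\ge2$, $A_\omega(\alpha)=\sum_{j:\alpha_j\ge1}A_\omega(\alpha-e_j)$; the weighted isobaric polynomial of level $n$ and weight $\omega$ is $P_{n,\omega}=\sum_{\alpha\vdash n}A_\omega(\alpha)t^\alpha$. Let $F_m=P_{m,(1,1,1,\ldots)}$ for $m\ge1$ and $F_0=1$. -}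

module Defs where

open import Data.Nat using (ℕ; zero; suc; _∸_) renaming (_+_ to _+ℕ_; _*_ to _*ℕ_)
import Data.Nat as ℕ
open import Data.List using (List; []; _∷_; map)
open import Data.Product using (_×_; _,_; proj₂)
open import Data.Maybe using (Maybe; just; nothing)
open import Data.Rational using (ℚ; 0ℚ; 1ℚ; _+_; _*_)
open import Relation.Nullary using (yes; no)

-- A monomial t^α is represented by the list (α₁ , α₂ , … , α_k):
-- the i-th entry (counting from 1) is the exponent of t_i; all
-- exponents beyond the end of the list are 0.  (Trailing zeros are
-- allowed; every definition below is insensitive to them.)
Mono : Set
Mono = List ℕ

Poly : Set
Poly = Mono → ℚ

-- A weight vector ω = (ω₁, ω₂, …): ω j is ω_j (ω 0 is never used).
Weight : Set
Weight = ℕ → ℚ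

size : Mono → ℕ
size [] = 0
size (a ∷ as) = a +ℕ size as

wt′ : ℕ → Mono → ℕ
wt′ k [] = 0
wt′ k (a ∷ as) = k *ℕ a +ℕ wt′ (suc k) as

wt : Mono → ℕ
wt = wt′ 1

dec : ℕ → Mono → List (ℕ × Mono)
dec k [] = []
dec k (zero ∷ as) = map (λ { (j , β) → (j , zero ∷ β) }) (dec (suc k) as)
dec k (suc a ∷ as) =
  (k , a ∷ as) ∷ map (λ { (j , β) → (j , suc a ∷ β) }) (dec (suc k) as)

sumℚ : List ℚ → ℚ
sumℚ [] = 0ℚ
sumℚ (x ∷ xs) = x + sumℚ xs

-- A′ ω s α computes A_ω(α) when s = |α| ≥ 1:
--   |α| = 1 : α = e_j and the sum has the single term ω_j ;
--   |α| ≥ 2 : A_ω(α) = Σ_{j : α_j ≥ 1} A_ω(α - e_j).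
A′ : Weight → ℕ → Mono → ℚ
A′ ω zero α = 0ℚ
A′ ω (suc zero) α = sumℚ (map (λ { (j , β) → ω j }) (dec 1 α))
A′ ω (suc (suc s)) α = sumℚ (map (A′ ω (suc s)) (map proj₂ (dec 1 α)))

A : Weight → Mono → ℚ
A ω α = A′ ω (size α) α

P : ℕ → Weight → Poly
P n ω α with wt α ℕ.≟ n
... | yes _ = A ω α
... | no _ = 0ℚ

ones : Weight
ones _ = 1ℚ

F : ℕ → Poly
F zero α with wt α ℕ.≟ 0
... | yes _ = 1ℚ
... | no _ = 0ℚ
F (suc m) = P (suc m) ones

-- β - e_j if β_j ≥ 1 (positions counted from 1), else nothing
lower : ℕ → Mono → Maybe Mono
lower j [] = nothing
lower zero (b ∷ bs) = nothing
lower (suc zero) (zero ∷ bs) = nothing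
lower (suc zero) (suc b ∷ bs) = just (b ∷ bs)
lower (suc (suc j)) (b ∷ bs) with lower (suc j) bs
... | just γ = just (b ∷ γ)
... | nothing = nothing

-- multiplication by the variable t_j
mulVar : ℕ → Poly → Poly
mulVar j p β with lower j β
... | just γ = p γ
... | nothing = 0ℚ

scale : ℚ → Poly → Poly
scale c p β = c * p β

_⊕_ : Poly → Poly → Poly
(p ⊕ q) β = p β + q β

zeroP : Poly
zeroP _ = 0ℚ

sumP : ℕ → (ℕ → Poly) → Poly
sumP zero f = zeroP
sumP (suc n) f = sumP n f ⊕ f (suc n)

{-# OPTIONS --safe #-}
module Submission where

-- Write t_j·p for mulVar j p, the series β ↦ p (β − e_j) (zero when β_j = 0).  On monomials
-- of level at most m the recursion defining A_ω reads A_ω = Σ_{j ≤ m} t_j·A_ω on size ≥ 2,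
-- and A_ω = Σ_{j ≤ m} ω_j t_j·1 on size 1.  Induction on the size then gives
--   A_ω (α) = Σ_j ω_j (t_j·A₁′ (|α| − 1)) (α),
-- where A₁′ s is A_(1,1,…) on size s ≥ 1 and A₁′ 0 = 1.  In the inductive step
-- Σ_i t_i·Σ_j ω_j t_j·A₁′ s is reordered to Σ_j ω_j t_j·Σ_i t_i·A₁′ s, which only uses
-- t_i t_j = t_j t_i, and Σ_i t_i·A₁′ s = A₁′ (s + 1) is the case ω = (1,1,…).  Finally
-- A₁′ |γ| γ is the coefficient of t^γ in F_{wt γ}, and t_j·F_{n−j} lives on level n.

open import Defs
open import Data.Nat using (ℕ; zero; suc; pred; _≤_; _∸_; _≟_; z≤n; s≤s)
  renaming (_+_ to _+ℕ_; _*_ to _*ℕ_)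
open import Data.Nat.Properties
  using (+-suc; +-identityʳ; *-zeroʳ; m≤n*m; m≤n+m; +-mono-≤; m+n≡0⇒m≡0; n≤0⇒n≡0; ≤-trans;
         ≤-reflexive; m+n≤o⇒m≤o; n≮n; m+n∸m≡n; m+[n∸m]≡n; suc-injective)
open import Data.Nat.Tactic.RingSolver using (solve-∀)
open import Data.Fin using (Fin; toℕ; inject₁; fromℕ)
open import Data.Fin.Properties using (toℕ<n; toℕ-inject₁; toℕ-fromℕ)
open import Data.List using ([]; _∷_; map)
open import Data.List.Properties using (map-∘)
open import Data.Maybe using (just; nothing; maybe′; _>>=_) renaming (map to mapᴹ)
open import Data.Product using (_×_; _,_)
open import Data.Rational using (ℚ; 0ℚ; 1ℚ; _+_; _*_)
open import Data.Rational.Properties as ℚ using (+-*-ring)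
open import Algebra.Bundles using (Ring)
open import Algebra.Properties.Semiring.Sum (Ring.semiring +-*-ring)
  using (sum-syntax; sum-cong-≗; sum-replicate-zero; sum-init-last; ∑-comm; *-distribˡ-sum)
open import Function using (_∘_)
open import Relation.Binary.PropositionalEquality
  using (_≡_; _≢_; refl; sym; trans; cong; cong₂; module ≡-Reasoning)
open import Relation.Nullary using (yes; no; contradiction)

open ≡-Reasoning

lower-∷ : ∀ i b bs → lower (suc (suc i)) (b ∷ bs) ≡ mapᴹ (b ∷_) (lower (suc i) bs)
lower-∷ i b bs with lower (suc i) bs
... | just γ = refl
... | nothing = refl

wt′-lower : ∀ k i β {γ} → lower (suc i) β ≡ just γ → wt′ k β ≡ (k +ℕ i) +ℕ wt′ k γ
wt′-lower k zero (suc a ∷ bs) refl = arith k a (wt′ (suc k) bs)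
  where
  arith : ∀ k a w → k *ℕ suc a +ℕ w ≡ (k +ℕ 0) +ℕ (k *ℕ a +ℕ w)
  arith = solve-∀
wt′-lower k (suc i) (b ∷ bs) e with lower (suc i) bs in eq
wt′-lower k (suc i) (b ∷ bs) refl | just γ =
  trans (cong (k *ℕ b +ℕ_) (wt′-lower (suc k) i bs eq)) (arith k b i (wt′ (suc k) γ))
  where
  arith : ∀ k b i w → k *ℕ b +ℕ ((suc k +ℕ i) +ℕ w) ≡ (k +ℕ suc i) +ℕ (k *ℕ b +ℕ w)
  arith = solve-∀

wt-lower : ∀ i β {γ} → lower (suc i) β ≡ just γ → wt β ≡ suc i +ℕ wt γ
wt-lower = wt′-lower 1

wt-lower-≤ : ∀ {m} i β {γ} → lower (suc i) β ≡ just γ → wt β ≤ m → wt γ ≤ m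
wt-lower-≤ i β e wtβ≤m =
  ≤-trans (≤-trans (m≤n+m _ (suc i)) (≤-reflexive (sym (wt-lower i β e)))) wtβ≤m

wt-lower-∸ : ∀ i β {γ} → lower (suc i) β ≡ just γ → wt γ ≡ wt β ∸ suc i
wt-lower-∸ i β {γ} e = sym (trans (cong (_∸ suc i) (wt-lower i β e)) (m+n∸m≡n (suc i) (wt γ)))

size-lower : ∀ i β {γ} → lower (suc i) β ≡ just γ → size β ≡ suc (size γ)
size-lower zero (suc a ∷ bs) refl = refl
size-lower (suc i) (b ∷ bs) e with lower (suc i) bs in eq
size-lower (suc i) (b ∷ bs) refl | just γ =
  trans (cong (b +ℕ_) (size-lower i bs eq)) (+-suc b (size γ))

lower-comm₁ : ∀ j β → (lower 1 β >>= lower (suc j)) ≡ (lower (suc j) β >>= lower 1)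
lower-comm₁ j [] = refl
lower-comm₁ zero (b ∷ bs) = refl
lower-comm₁ (suc j) (zero ∷ bs) with lower (suc j) bs
... | just _ = refl
... | nothing = refl
lower-comm₁ (suc j) (suc b ∷ bs) with lower (suc j) bs
... | just _ = refl
... | nothing = refl

lower-comm : ∀ i j β → (lower (suc i) β >>= lower (suc j)) ≡ (lower (suc j) β >>= lower (suc i))
lower-comm i j [] = refl
lower-comm zero j β = lower-comm₁ j β
lower-comm (suc i) zero β = sym (lower-comm₁ (suc i) β)
lower-comm (suc i) (suc j) (b ∷ bs) = begin
  (lower (2 +ℕ i) (b ∷ bs) >>= lower (2 +ℕ j))          ≡⟨ cong (_>>= lower (2 +ℕ j)) (lower-∷ i b bs) ⟩
  (mapᴹ (b ∷_) (lower (suc i) bs) >>= lower (2 +ℕ j))   ≡⟨ bind-lower-∷ j (lower (suc i) bs) ⟩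
  mapᴹ (b ∷_) (lower (suc i) bs >>= lower (suc j))      ≡⟨ cong (mapᴹ (b ∷_)) (lower-comm i j bs) ⟩
  mapᴹ (b ∷_) (lower (suc j) bs >>= lower (suc i))      ≡⟨ bind-lower-∷ i (lower (suc j) bs) ⟨
  (mapᴹ (b ∷_) (lower (suc j) bs) >>= lower (2 +ℕ i))   ≡⟨ cong (_>>= lower (2 +ℕ i)) (lower-∷ j b bs) ⟨
  (lower (2 +ℕ j) (b ∷ bs) >>= lower (2 +ℕ i))          ∎
  where
  bind-lower-∷ : ∀ k m → (mapᴹ (b ∷_) m >>= lower (2 +ℕ k)) ≡ mapᴹ (b ∷_) (m >>= lower (suc k))
  bind-lower-∷ k nothing = refl
  bind-lower-∷ k (just γ) = lower-∷ k b γ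

size≤wt′ : ∀ k β → size β ≤ wt′ (suc k) β
size≤wt′ k [] = z≤n
size≤wt′ k (b ∷ bs) = +-mono-≤ (m≤n*m b (suc k)) (size≤wt′ (suc k) bs)

size≡0⇒wt′≡0 : ∀ k β → size β ≡ 0 → wt′ k β ≡ 0
size≡0⇒wt′≡0 k [] _ = refl
size≡0⇒wt′≡0 k (b ∷ bs) e with refl ← m+n≡0⇒m≡0 b e =
  trans (cong (_+ℕ wt′ (suc k) bs) (*-zeroʳ k)) (size≡0⇒wt′≡0 (suc k) bs e)

mulVar-cong-local : ∀ j {p q : Poly} β → (∀ γ → lower j β ≡ just γ → p γ ≡ q γ) →
                    mulVar j p β ≡ mulVar j q β
mulVar-cong-local j β p≡q with lower j β
... | just γ = p≡q γ refl
... | nothing = refl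

mulVar-vanish : ∀ j {p : Poly} β → (∀ γ → lower j β ≡ just γ → p γ ≡ 0ℚ) → mulVar j p β ≡ 0ℚ
mulVar-vanish j β p≡0 with lower j β
... | just γ = p≡0 γ refl
... | nothing = refl

mulVar-∷ : ∀ i p b bs → mulVar (suc (suc i)) p (b ∷ bs) ≡ mulVar (suc i) (p ∘ (b ∷_)) bs
mulVar-∷ i p b bs with lower (suc i) bs
... | just γ = refl
... | nothing = refl

mulVar-scale : ∀ j c p β → mulVar j (scale c p) β ≡ c * mulVar j p β
mulVar-scale j c p β with lower j β
... | just γ = refl
... | nothing = sym (ℚ.*-zeroʳ c)

mulVar-∑ : ∀ j n (p : Fin n → Poly) β →
           mulVar j (λ γ → ∑[ k < n ] p k γ) β ≡ ∑[ k < n ] mulVar j (p k) β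
mulVar-∑ j n p β with lower j β
... | just γ = refl
... | nothing = sym (sum-replicate-zero n)

mulVar-comm : ∀ i j p β → mulVar (suc i) (mulVar (suc j) p) β ≡ mulVar (suc j) (mulVar (suc i) p) β
mulVar-comm i j p β = begin
  mulVar (suc i) (mulVar (suc j) p) β               ≡⟨ mulVar-mulVar (suc i) (suc j) ⟩
  maybe′ p 0ℚ (lower (suc i) β >>= lower (suc j))   ≡⟨ cong (maybe′ p 0ℚ) (lower-comm i j β) ⟩
  maybe′ p 0ℚ (lower (suc j) β >>= lower (suc i))   ≡⟨ mulVar-mulVar (suc j) (suc i) ⟨
  mulVar (suc j) (mulVar (suc i) p) β               ∎
  where
  mulVar-mulVar : ∀ k l → mulVar k (mulVar l p) β ≡ maybe′ p 0ℚ (lower k β >>= lower l)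
  mulVar-mulVar k l with lower k β
  ... | nothing = refl
  ... | just γ with lower l γ
  ...   | nothing = refl
  ...   | just δ = refl

ι : ∀ {m} → Fin m → ℕ
ι i = suc (toℕ i)

Supported : ℕ → Mono → Set
Supported m β = ∀ i {γ} → m ≤ i → lower (suc i) β ≢ just γ

wt-supported : ∀ {m} β → wt β ≤ m → Supported m β
wt-supported β wtβ≤m i m≤i e =
  n≮n i (≤-trans (m+n≤o⇒m≤o (suc i) (≤-trans (≤-reflexive (sym (wt-lower i β e))) wtβ≤m)) m≤i)

supported-∷ : ∀ {m} b bs → Supported m (b ∷ bs) → Supported (pred m) bs
supported-∷ {m} b bs supp i pred[m]≤i e =
  supp (suc i) (pred≤⇒≤suc m pred[m]≤i) (trans (lower-∷ i b bs) (cong (mapᴹ (b ∷_)) e))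
  where
  pred≤⇒≤suc : ∀ m → pred m ≤ i → m ≤ suc i
  pred≤⇒≤suc zero _ = z≤n
  pred≤⇒≤suc (suc m) = s≤s

sumℚ-map-dec-∷ : ∀ k (g : ℕ × Mono → ℚ) b bs →
  sumℚ (map g (dec k (b ∷ bs))) ≡
  mulVar 1 (λ γ → g (k , γ)) (b ∷ bs) + sumℚ (map (λ { (j , γ) → g (j , b ∷ γ) }) (dec (suc k) bs))
sumℚ-map-dec-∷ k g zero bs =
  trans (cong sumℚ (sym (map-∘ (dec (suc k) bs)))) (sym (ℚ.+-identityˡ _))
sumℚ-map-dec-∷ k g (suc b) bs =
  cong (λ xs → g (k , b ∷ bs) + sumℚ xs) (sym (map-∘ (dec (suc k) bs)))

sumℚ-map-dec : ∀ k m (g : ℕ × Mono → ℚ) β → Supported m β →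
  sumℚ (map g (dec k β)) ≡ ∑[ i < m ] mulVar (ι i) (λ γ → g (k +ℕ toℕ i , γ)) β
sumℚ-map-dec k m g [] _ = sym (sum-replicate-zero m)
sumℚ-map-dec k zero g (b ∷ bs) supp = begin
  sumℚ (map g (dec k (b ∷ bs)))                                       ≡⟨ sumℚ-map-dec-∷ k g b bs ⟩
  mulVar 1 (λ γ → g (k , γ)) (b ∷ bs) + sumℚ (map g′ (dec (suc k) bs))
    ≡⟨ cong₂ _+_ (mulVar-vanish 1 (b ∷ bs) (λ γ e → contradiction e (supp 0 z≤n)))
                 (sumℚ-map-dec (suc k) 0 g′ bs (supported-∷ b bs supp)) ⟩
  0ℚ + 0ℚ                                                             ≡⟨ ℚ.+-identityˡ 0ℚ ⟩
  0ℚ                                                                  ∎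
  where
  g′ : ℕ × Mono → ℚ
  g′ (j , γ) = g (j , b ∷ γ)
sumℚ-map-dec k (suc m) g (b ∷ bs) supp = begin
  sumℚ (map g (dec k (b ∷ bs)))                                       ≡⟨ sumℚ-map-dec-∷ k g b bs ⟩
  mulVar 1 (λ γ → g (k , γ)) (b ∷ bs) + sumℚ (map g′ (dec (suc k) bs))
    ≡⟨ cong₂ _+_ (cong (λ j → mulVar 1 (λ γ → g (j , γ)) (b ∷ bs)) (sym (+-identityʳ k)))
                 (sumℚ-map-dec (suc k) m g′ bs (supported-∷ b bs supp)) ⟩
  mulVar 1 (λ γ → g (k +ℕ 0 , γ)) (b ∷ bs) +
  ∑[ i < m ] mulVar (ι i) (λ γ → g (suc k +ℕ toℕ i , b ∷ γ)) bs
    ≡⟨ cong (mulVar 1 (λ γ → g (k +ℕ 0 , γ)) (b ∷ bs) +_) (sum-cong-≗ {m} shift) ⟩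
  ∑[ i < suc m ] mulVar (ι i) (λ γ → g (k +ℕ toℕ i , γ)) (b ∷ bs)    ∎
  where
  g′ : ℕ × Mono → ℚ
  g′ (j , γ) = g (j , b ∷ γ)
  shift : ∀ i → mulVar (ι i) (λ γ → g (suc k +ℕ toℕ i , b ∷ γ)) bs ≡
                mulVar (suc (ι i)) (λ γ → g (k +ℕ ι i , γ)) (b ∷ bs)
  shift i = sym (trans (mulVar-∷ (toℕ i) _ b bs)
                       (cong (λ j → mulVar (ι i) (λ γ → g (j , b ∷ γ)) bs) (+-suc k (toℕ i))))

A′-one : ∀ ω m α → wt α ≤ m → A′ ω 1 α ≡ ∑[ i < m ] mulVar (ι i) (λ _ → ω (ι i)) α
A′-one ω m α wtα≤m = sumℚ-map-dec 1 m _ α (wt-supported α wtα≤m)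

A′-step : ∀ ω s m α → wt α ≤ m → A′ ω (2 +ℕ s) α ≡ ∑[ i < m ] mulVar (ι i) (A′ ω (suc s)) α
A′-step ω s m α wtα≤m =
  trans (cong sumℚ (sym (map-∘ (dec 1 α)))) (sumℚ-map-dec 1 m _ α (wt-supported α wtα≤m))

-- A′ ω 0 is 0; A₁′ 0 is 1 instead, matching F₀ = 1.
A₁′ : ℕ → Poly
A₁′ zero _ = 1ℚ
A₁′ (suc s) = A′ ones (suc s)

A₁′-step : ∀ s m β → wt β ≤ m → A₁′ (suc s) β ≡ ∑[ i < m ] mulVar (ι i) (A₁′ s) β
A₁′-step zero = A′-one ones
A₁′-step (suc s) = A′-step ones s

∑-mulVar-exchange : ∀ m (c : ℕ → ℚ) (p : Poly) α →
  ∑[ i < m ] mulVar (ι i) (λ γ → ∑[ j < m ] (c (ι j) * mulVar (ι j) p γ)) α ≡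
  ∑[ j < m ] (c (ι j) * mulVar (ι j) (λ γ → ∑[ i < m ] mulVar (ι i) p γ) α)
∑-mulVar-exchange m c p α = begin
  ∑[ i < m ] mulVar (ι i) (λ γ → ∑[ j < m ] (c (ι j) * mulVar (ι j) p γ)) α
    ≡⟨ sum-cong-≗ {m} (λ i → mulVar-∑ (ι i) m (λ j → scale (c (ι j)) (mulVar (ι j) p)) α) ⟩
  ∑[ i < m ] ∑[ j < m ] mulVar (ι i) (scale (c (ι j)) (mulVar (ι j) p)) α
    ≡⟨ sum-cong-≗ {m} (λ i → sum-cong-≗ {m} (λ j →
         mulVar-scale (ι i) (c (ι j)) (mulVar (ι j) p) α)) ⟩
  ∑[ i < m ] ∑[ j < m ] (c (ι j) * mulVar (ι i) (mulVar (ι j) p) α)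
    ≡⟨ ∑-comm {m} {m} (λ i j → c (ι j) * mulVar (ι i) (mulVar (ι j) p) α) ⟩
  ∑[ j < m ] ∑[ i < m ] (c (ι j) * mulVar (ι i) (mulVar (ι j) p) α)
    ≡⟨ sum-cong-≗ {m} (λ j → sum-cong-≗ {m} (λ i →
         cong (c (ι j) *_) (mulVar-comm (toℕ i) (toℕ j) p α))) ⟩
  ∑[ j < m ] ∑[ i < m ] (c (ι j) * mulVar (ι j) (mulVar (ι i) p) α)
    ≡⟨ sum-cong-≗ {m} (λ j → *-distribˡ-sum {m} (c (ι j)) (λ i → mulVar (ι j) (mulVar (ι i) p) α)) ⟨
  ∑[ j < m ] (c (ι j) * ∑[ i < m ] mulVar (ι j) (mulVar (ι i) p) α)
    ≡⟨ sum-cong-≗ {m} (λ j → cong (c (ι j) *_) (mulVar-∑ (ι j) m (λ i → mulVar (ι i) p) α)) ⟨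
  ∑[ j < m ] (c (ι j) * mulVar (ι j) (λ γ → ∑[ i < m ] mulVar (ι i) p γ) α)
    ∎

A′-expansion : ∀ ω s m α → wt α ≤ m → A′ ω (suc s) α ≡ ∑[ i < m ] (ω (ι i) * mulVar (ι i) (A₁′ s) α)
A′-expansion ω zero m α wtα≤m = trans (A′-one ω m α wtα≤m) (sum-cong-≗ {m} pull-weight)
  where
  pull-weight : ∀ i → mulVar (ι i) (λ _ → ω (ι i)) α ≡ ω (ι i) * mulVar (ι i) (λ _ → 1ℚ) α
  pull-weight i = trans (mulVar-cong-local (ι i) α (λ _ _ → sym (ℚ.*-identityʳ (ω (ι i)))))
                        (mulVar-scale (ι i) (ω (ι i)) (λ _ → 1ℚ) α)
A′-expansion ω (suc s) m α wtα≤m = begin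
  A′ ω (2 +ℕ s) α
    ≡⟨ A′-step ω s m α wtα≤m ⟩
  ∑[ i < m ] mulVar (ι i) (A′ ω (suc s)) α
    ≡⟨ sum-cong-≗ {m} (λ i → mulVar-cong-local (ι i) α (λ γ e →
         A′-expansion ω s m γ (wt-lower-≤ (toℕ i) α e wtα≤m))) ⟩
  ∑[ i < m ] mulVar (ι i) (λ γ → ∑[ j < m ] (ω (ι j) * mulVar (ι j) (A₁′ s) γ)) α
    ≡⟨ ∑-mulVar-exchange m ω (A₁′ s) α ⟩
  ∑[ j < m ] (ω (ι j) * mulVar (ι j) (λ γ → ∑[ i < m ] mulVar (ι i) (A₁′ s) γ) α)
    ≡⟨ sum-cong-≗ {m} (λ j → cong (ω (ι j) *_) (mulVar-cong-local (ι j) α (λ γ e →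
         A₁′-step s m γ (wt-lower-≤ (toℕ j) α e wtα≤m)))) ⟨
  ∑[ j < m ] (ω (ι j) * mulVar (ι j) (A₁′ (suc s)) α)
    ∎

F-coeff : ∀ w γ → wt γ ≡ w → F w γ ≡ A₁′ (size γ) γ
F-coeff zero γ wtγ≡0 with wt γ ≟ 0
... | no wtγ≢0 = contradiction wtγ≡0 wtγ≢0
... | yes _ rewrite n≤0⇒n≡0 (≤-trans (size≤wt′ 0 γ) (≤-reflexive wtγ≡0)) = refl
F-coeff (suc w) γ wtγ≡1+w with wt γ ≟ suc w
... | no wtγ≢1+w = contradiction wtγ≡1+w wtγ≢1+w
... | yes _ with size γ in sizeγ≡
...   | suc s = refl
...   | zero = contradiction (trans (sym wtγ≡1+w) (size≡0⇒wt′≡0 1 γ sizeγ≡)) λ ()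

F-off : ∀ w γ → wt γ ≢ w → F w γ ≡ 0ℚ
F-off zero γ wtγ≢0 with wt γ ≟ 0
... | yes wtγ≡0 = contradiction wtγ≡0 wtγ≢0
... | no _ = refl
F-off (suc w) γ wtγ≢1+w with wt γ ≟ suc w
... | yes wtγ≡1+w = contradiction wtγ≡1+w wtγ≢1+w
... | no _ = refl

A-expansion-on-level : ∀ ω n β → 1 ≤ n → wt β ≡ n →
                       A ω β ≡ ∑[ i < n ] (ω (ι i) * mulVar (ι i) (F (n ∸ ι i)) β)
A-expansion-on-level ω n β 1≤n wtβ≡n with size β in sizeβ≡
... | zero = contradiction (≤-trans 1≤n (≤-reflexive n≡0)) (n≮n 0)
  where
  n≡0 : n ≡ 0
  n≡0 = trans (sym wtβ≡n) (size≡0⇒wt′≡0 1 β sizeβ≡)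
... | suc s = trans (A′-expansion ω s n β (≤-reflexive wtβ≡n))
                    (sum-cong-≗ {n} λ i → cong (ω (ι i) *_) (mulVar-cong-local (ι i) β (A₁′≡F i)))
  where
  A₁′≡F : ∀ (i : Fin n) γ → lower (ι i) β ≡ just γ → A₁′ s γ ≡ F (n ∸ ι i) γ
  A₁′≡F i γ e = begin
    A₁′ s γ          ≡⟨ cong (λ t → A₁′ t γ) sizeγ≡s ⟨
    A₁′ (size γ) γ   ≡⟨ F-coeff (n ∸ ι i) γ wtγ≡ ⟨
    F (n ∸ ι i) γ    ∎
    where
    sizeγ≡s : size γ ≡ s
    sizeγ≡s = suc-injective (trans (sym (size-lower (toℕ i) β e)) sizeβ≡)
    wtγ≡ : wt γ ≡ n ∸ ι i
    wtγ≡ = trans (wt-lower-∸ (toℕ i) β e) (cong (_∸ ι i) wtβ≡n)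

expansion-off-level : ∀ (ω : Weight) n β → wt β ≢ n →
                      ∑[ i < n ] (ω (ι i) * mulVar (ι i) (F (n ∸ ι i)) β) ≡ 0ℚ
expansion-off-level ω n β wtβ≢n = trans (sum-cong-≗ {n} term-vanishes) (sum-replicate-zero n)
  where
  term-vanishes : ∀ (i : Fin n) → ω (ι i) * mulVar (ι i) (F (n ∸ ι i)) β ≡ 0ℚ
  term-vanishes i =
    trans (cong (ω (ι i) *_) (mulVar-vanish (ι i) β λ γ e → F-off (n ∸ ι i) γ (off-level γ e)))
          (ℚ.*-zeroʳ (ω (ι i)))
    where
    off-level : ∀ γ → lower (ι i) β ≡ just γ → wt γ ≢ n ∸ ι i
    off-level γ e wtγ≡ = wtβ≢n (begin
      wt β               ≡⟨ wt-lower (toℕ i) β e ⟩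
      ι i +ℕ wt γ        ≡⟨ cong (ι i +ℕ_) wtγ≡ ⟩
      ι i +ℕ (n ∸ ι i)   ≡⟨ m+[n∸m]≡n (toℕ<n i) ⟩
      n                  ∎)

P-expansion : ∀ ω n β → 1 ≤ n → P n ω β ≡ ∑[ i < n ] (ω (ι i) * mulVar (ι i) (F (n ∸ ι i)) β)
P-expansion ω n β 1≤n with wt β ≟ n
... | yes wtβ≡n = A-expansion-on-level ω n β 1≤n wtβ≡n
... | no wtβ≢n = sym (expansion-off-level ω n β wtβ≢n)

sumP-∑ : ∀ n (f : ℕ → Poly) β → sumP n f β ≡ ∑[ i < n ] f (ι i) β
sumP-∑ zero f β = refl
sumP-∑ (suc n) f β = begin
  sumP n f β + f (suc n) β                             ≡⟨ cong (_+ f (suc n) β) (sumP-∑ n f β) ⟩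
  ∑[ i < n ] f (ι i) β + f (suc n) β                   ≡⟨ cong₂ _+_ (sum-cong-≗ {n} init≗) last≡ ⟨
  ∑[ i < n ] f (ι (inject₁ i)) β + f (ι (fromℕ n)) β   ≡⟨ sum-init-last {n} (λ i → f (ι i) β) ⟨
  ∑[ i < suc n ] f (ι i) β                             ∎
  where
  init≗ : ∀ i → f (ι (inject₁ i)) β ≡ f (ι i) β
  init≗ i = cong (λ k → f (suc k) β) (toℕ-inject₁ i)
  last≡ : f (ι (fromℕ n)) β ≡ f (suc n) β
  last≡ = cong (λ k → f (suc k) β) (toℕ-fromℕ n)

lemma4 : (ω : Weight) (n : ℕ) → 1 ≤ n → (β : Mono) →
         P n ω β ≡ sumP n (λ j → scale (ω j) (mulVar j (F (n ∸ j)))) β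
lemma4 ω n 1≤n β = trans (P-expansion ω n β 1≤n) (sym (sumP-∑ n _ β))
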